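{- Let $\alpha>1/2$. There is no online algorithm for the strict dynamic case of \textsc{Knapsack} that has competitive ratio $\alpha$ and an amortized migration factor bounded by a constant (independent of the instance), when migration is measured by weight.
   Context: \textsc{Knapsack}: a capacity $C\in\mathbb N$ and items $i$ with weight $w_i\in\mathbb N$ and profit $p_i\in\mathbb N$; a subset is feasible iff its total weight is at most $C$, and its profit is the sum of its profits. Strict dynamic case: the instance starts empty, and at each time step one item arrives or one present item departs. The algorithm outputs a feasible $S_t$ at each time without knowledge of the future. Competitive ratio $\alpha$ means $\mathrm{profit}(S_t)\ge\alpha\,\mathrm{opt}(I_t)$ for all $t$. Migration measured by weight: the migration potential of a step is the weight of the arriving or departing item. The migration cost of changing $S_{t-1}$ to $S_t$ is the total weight of $S_{t-1}\triangle S_t$, excluding the initial inclusion of a newly arrived item. The amortized migration factor is bounded by $B$ if for every $t$ the total migration cost up to $t$ is at most $B$ times the total migration potential up to $t$.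
   Formalization: The competitive ratio α and the bound B on the amortized migration factor range over the rationals. -}

module Defs where

open import Data.Nat using (ℕ; zero; suc; _+_; _≤_; _≡ᵇ_)
open import Data.Bool using (Bool; true; false; _∧_; not; if_then_else_; _xor_)
open import Data.List using (List; []; _∷_; filter; length; map)
open import Data.Nat.ListAction using (sum)
open import Data.List.Relation.Unary.Any using (Any)
open import Data.Product using (_×_; Σ)
open import Data.Unit using (⊤)
open import Data.Integer using (+_)
open import Data.Rational using (ℚ; _/_; _*_)
import Data.Rational as Q
open import Relation.Binary.PropositionalEquality using (_≡_)
open import Relation.Nullary using (¬_)
open import Relation.Nullary.Decidable using (does)
open import Data.Bool.Properties using (T?)
open import Data.Bool using (T)

-- An item present in the instance: its identifier (= the time step at which
-- it arrived), its weight and its profit.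
record Item : Set where
  constructor item
  field
    ident  : ℕ
    weight : ℕ
    profit : ℕ
open Item public

data Event : Set where
  arrive : (w p : ℕ) → Event
  depart : (i : ℕ) → Event

-- A history is the list of events so far, MOST RECENT FIRST.
-- The item arriving at the event preceded by the history h gets id (length h).
History : Set
History = List Event

stays : Event → Item → Bool
stays (arrive w p) it = true
stays (depart i)   it = not (ident it ≡ᵇ i)

present : History → List Item
present []                 = []
present (arrive w p ∷ h)   = item (length h) w p ∷ present h
present (e@(depart i) ∷ h) = filter (λ it → T? (stays e it)) (present h)

-- Strict dynamic case: every departure concerns an item currently present.
Valid : History → Set
Valid []                 = ⊤
Valid (arrive w p ∷ h)   = Valid h
Valid (depart i ∷ h)     = Valid h × Any (λ it → ident it ≡ i) (present h)

totalWeight : List Item → ℕ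
totalWeight xs = sum (map weight xs)

totalProfit : List Item → ℕ
totalProfit xs = sum (map profit xs)

select : (ℕ → Bool) → List Item → List Item
select f xs = filter (λ it → T? (f (ident it))) xs

-- A (deterministic) online algorithm: given the capacity C and the history
-- up to the current time, it marks which item ids belong to its solution.  Since the output at
-- time t is a function of the history up to t only, it has no knowledge of
-- the future.
Algorithm : Set
Algorithm = ℕ → History → (ℕ → Bool)

solution : Algorithm → ℕ → History → List Item
solution A C h = select (A C h) (present h)

-- Feasibility of S_t (S_t ⊆ I_t holds by construction).
Feasible : ℕ → List Item → Set
Feasible C S = totalWeight S ≤ C

inSol : Algorithm → ℕ → History → Item → Bool
inSol A C h it = A C h (ident it)

-- Migration cost of the step whose event is e and prior history h:
-- weight of S_{t-1} △ S_t, excluding the initial inclusion of the newly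
-- arrived item (the only item of I_t not in I_{t-1}).
stepCost : Algorithm → ℕ → Event → History → ℕ
stepCost A C e h =
  sum (map (λ it → if inSol A C h it xor (stays e it ∧ inSol A C (e ∷ h) it)
                   then weight it else 0)
           (present h))

stepPotential : Event → History → ℕ
stepPotential (arrive w p) h = w
stepPotential (depart i)   h =
  totalWeight (filter (λ it → T? (ident it ≡ᵇ i)) (present h))

totalCost : Algorithm → ℕ → History → ℕ
totalCost A C []      = 0
totalCost A C (e ∷ h) = stepCost A C e h + totalCost A C h

totalPotential : History → ℕ
totalPotential []      = 0
totalPotential (e ∷ h) = stepPotential e h + totalPotential h

toℚ : ℕ → ℚ
toℚ n = + n / 1

Competitive : ℚ → ℕ → History → List Item → Set
Competitive α C h S =
  (f : ℕ → Bool) → Feasible C (select f (present h)) →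
  α * toℚ (totalProfit (select f (present h))) Q.≤ toℚ (totalProfit S)

GoodAlgorithm : ℚ → ℚ → Algorithm → Set
GoodAlgorithm α B A =
  (C : ℕ) (h : History) → Valid h →
    Feasible C (solution A C h)
    × Competitive α C h (solution A C h)
    × toℚ (totalCost A C h) Q.≤ B * toℚ (totalPotential h)

{-# OPTIONS --safe #-}
-- A large item (weight C, profit 1) arrives, and then k times a small item
-- (weight 1, profit 2) arrives and immediately departs.  Alone, the large item
-- must be packed, since any positive ratio forbids the empty solution.  Next to
-- the small item it must be unpacked: both do not fit, and packing the large item
-- alone earns 1 < 2α.  So each round of potential 2 costs migration 2C, and after
-- k = C rounds the cost 2C² exceeds B times the potential 3C once C > 3B/2.
module Submission where

open import Defs
open import Data.Rational using (ℚ; ½; _<_)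
open import Data.Product using (Σ; _,_; proj₁; proj₂)
open import Relation.Nullary using (¬_)

open import Data.Bool using (Bool; true; false; not; T)
open import Data.Bool.Properties using (T-≡; T?)
open import Data.Empty using (⊥-elim)
open import Data.Integer as ℤ using (+_; ∣_∣)
import Data.Integer.Properties as ℤP
open import Data.List using ([]; _∷_; length)
open import Data.List.Properties using (filter-accept; filter-reject)
open import Data.List.Relation.Unary.Any using (here)
open import Data.Nat as ℕ using (ℕ; zero; suc; _+_; _*_; _≡ᵇ_; z≤n; s≤s; NonZero)
import Data.Nat.Coprimality as Coprimality
import Data.Nat.Properties as ℕP
open import Data.Nat.Tactic.RingSolver using (solve-∀)
open import Data.Rational as ℚ using (↥_)
import Data.Rational.Properties as ℚP
open import Data.Rational.Unnormalised as ℚᵘ using (mkℚᵘ)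
import Data.Rational.Unnormalised.Properties as ℚᵘP
open import Data.Unit using (tt)
open import Function using (_∘_)
open import Function.Bundles using (Equivalence)
open import Relation.Binary.PropositionalEquality

m*3n<n*2n : ∀ m n .{{_ : NonZero n}} → m + m + m ℕ.< n + n → m * (n + (n + n)) ℕ.< n * (n + n)
m*3n<n*2n m n 3m<2n = begin-strict
  m * (n + (n + n)) ≡⟨ regroup m n ⟩
  (m + m + m) * n   <⟨ ℕP.*-monoˡ-< n 3m<2n ⟩
  (n + n) * n       ≡⟨ ℕP.*-comm (n + n) n ⟩
  n * (n + n)       ∎
  where
  open ℕP.≤-Reasoning
  regroup : ∀ m n → m * (n + (n + n)) ≡ (m + m + m) * n
  regroup = solve-∀

i≤+∣i∣ : ∀ i → i ℤ.≤ + ∣ i ∣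
i≤+∣i∣ (+ n)      = ℤP.≤-refl
i≤+∣i∣ ℤ.-[1+ n ] = ℤ.-≤+

cross-≤⇒≤-∣∣* : ∀ {c k p} i → + c ℤ.* + suc k ℤ.≤ i ℤ.* + p ℤ.* + 1 → c ℕ.≤ ∣ i ∣ * p
cross-≤⇒≤-∣∣* {c} {k} {p} i le = ℕP.≤-trans (ℕP.m≤m*n c (suc k)) (ℤP.drop‿+≤+ (begin
  + (c * suc k)     ≡⟨ ℤP.pos-* c (suc k) ⟩
  + c ℤ.* + suc k   ≤⟨ le ⟩
  i ℤ.* + p ℤ.* + 1 ≡⟨ ℤP.*-identityʳ _ ⟩
  i ℤ.* + p         ≤⟨ i≤+∣i∣ _ ⟩
  + ∣ i ℤ.* + p ∣   ≡⟨ cong +_ (ℤP.abs-* i (+ p)) ⟩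
  + (∣ i ∣ * p)     ∎))
  where open ℤP.≤-Reasoning

toℚᵘ-toℚ : ∀ n → ℚ.toℚᵘ (toℚ n) ≡ mkℚᵘ (+ n) 0
toℚᵘ-toℚ n = cong ℚ.toℚᵘ (ℚP.normalize-coprime (Coprimality.sym (Coprimality.1-coprimeTo n)))

toℚ≤q*toℚ⇒≤∣↥q∣* : ∀ q c p → toℚ c ℚ.≤ q ℚ.* toℚ p → c ℕ.≤ ∣ ↥ q ∣ * p
toℚ≤q*toℚ⇒≤∣↥q∣* q@(ℚ.mkℚ n d _) c p le = cross-≤⇒≤-∣∣* n (ℚᵘP.drop-*≤* leᵘ)
  where
  leᵘ : mkℚᵘ (+ c) 0 ℚᵘ.≤ ℚ.toℚᵘ q ℚᵘ.* mkℚᵘ (+ p) 0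
  leᵘ = subst₂ (λ x y → x ℚᵘ.≤ ℚ.toℚᵘ q ℚᵘ.* y) (toℚᵘ-toℚ c) (toℚᵘ-toℚ p)
          (ℚᵘP.≤-respʳ-≃ (ℚP.toℚᵘ-homo-* q (toℚ p)) (ℚP.toℚᵘ-mono-≤ le))

≡ᵇ-refl : ∀ n → (n ≡ᵇ n) ≡ true
≡ᵇ-refl n = Equivalence.to T-≡ (ℕP.≡⇒≡ᵇ n n refl)

select-accept : ∀ f it {xs} → f (ident it) ≡ true → select f (it ∷ xs) ≡ it ∷ select f xs
select-accept f it eq = filter-accept (λ it → T? (f (ident it))) (Equivalence.from T-≡ eq)

select-reject : ∀ f it {xs} → f (ident it) ≡ false → select f (it ∷ xs) ≡ select f xs
select-reject f it eq = filter-reject (λ it → T? (f (ident it))) (subst T eq)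

competitive-on : ∀ {α C h} A {xs} → present h ≡ xs → Competitive α C h (solution A C h) →
                 (f : ℕ → Bool) → Feasible C (select f xs) →
                 α ℚ.* toℚ (totalProfit (select f xs)) ℚ.≤ toℚ (totalProfit (select (A C h) xs))
competitive-on A refl competitive = competitive

large : ℕ → Item
large C = item 0 C 1

small : ℕ → Item
small j = item (suc j) 1 2

large-kept : ∀ {α} → ℚ.0ℚ < α → ∀ A C h → present h ≡ large C ∷ [] →
             Competitive α C h (solution A C h) → A C h 0 ≡ true
large-kept {α} 0<α A C h eq competitive with A C h 0 in rejected
... | true  = refl
... | false = ⊥-elim (ℚP.<-irrefl refl (ℚP.<-≤-trans 0<α (subst (ℚ._≤ toℚ 0) (ℚP.*-identityʳ α) α*1≤0)))
  where
  α*1≤0 : α ℚ.* toℚ 1 ℚ.≤ toℚ 0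
  α*1≤0 = subst (λ S → α ℚ.* toℚ 1 ℚ.≤ toℚ (totalProfit S)) (select-reject (A C h) (large C) rejected)
            (competitive-on {α} A eq competitive (λ _ → true) (ℕP.≤-reflexive (ℕP.+-identityʳ C)))

large-dropped : ∀ {α} → ½ < α → ∀ A C j h → 1 ℕ.≤ C → present h ≡ small j ∷ large C ∷ [] →
                Feasible C (solution A C h) → Competitive α C h (solution A C h) → A C h 0 ≡ false
large-dropped {α} ½<α A C j h 1≤C eq feasible competitive with A C h 0 in large-in
... | false = refl
... | true with A C h (suc j) in small-in
...   | true  = ⊥-elim (ℕP.<⇒≱ (s≤s (ℕP.m≤m+n C 0)) both-feasible)
  where
  both-feasible : Feasible C (small j ∷ large C ∷ [])
  both-feasible = subst (Feasible C)
    (trans (cong (select (A C h)) eq) (trans (select-accept (A C h) (small j) small-in)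
                                             (cong (small j ∷_) (select-accept (A C h) (large C) large-in))))
    feasible
...   | false = ⊥-elim (ℚP.<-irrefl refl (ℚP.<-≤-trans (ℚP.*-monoˡ-<-pos (toℚ 2) ½<α) α*2≤1))
  where
  α*2≤1 : α ℚ.* toℚ 2 ℚ.≤ toℚ 1
  α*2≤1 = subst (λ S → α ℚ.* toℚ 2 ℚ.≤ toℚ (totalProfit S))
            (trans (select-reject (A C h) (small j) small-in) (select-accept (A C h) (large C) large-in))
            (competitive-on {α} A eq competitive (λ i → not (i ≡ᵇ 0)) 1≤C)

adversary : ℕ → ℕ → History
adversary C zero    = arrive C 1 ∷ []
adversary C (suc k) = depart (length (adversary C k)) ∷ arrive 1 2 ∷ adversary C k

length-adversary : ∀ C k → length (adversary C k) ≡ suc (k + k)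
length-adversary C zero    = refl
length-adversary C (suc k) rewrite length-adversary C k = cong (suc ∘ suc) (sym (ℕP.+-suc k k))

valid-adversary : ∀ C k → Valid (adversary C k)
valid-adversary C zero    = tt
valid-adversary C (suc k) = valid-adversary C k , here refl

present-adversary : ∀ C k → present (adversary C k) ≡ large C ∷ []
present-adversary C zero    = refl
present-adversary C (suc k)
  rewrite present-adversary C k | length-adversary C k | ≡ᵇ-refl (k + k) = refl

present-adversary-arrive : ∀ C k → present (arrive 1 2 ∷ adversary C k) ≡ small (k + k) ∷ large C ∷ []
present-adversary-arrive C k rewrite present-adversary C k | length-adversary C k = refl

totalPotential-adversary : ∀ C k → totalPotential (adversary C k) ≡ C + (k + k)
totalPotential-adversary C zero    = refl
totalPotential-adversary C (suc k)
  rewrite present-adversary C k | length-adversary C k | ≡ᵇ-refl (k + k) | totalPotential-adversary C k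
        | ℕP.+-suc k k | ℕP.+-suc C (suc (k + k)) | ℕP.+-suc C (k + k) = refl

module _ (A : Algorithm) (C : ℕ)
         (kept    : ∀ k → A C (adversary C k) 0 ≡ true)
         (dropped : ∀ k → A C (arrive 1 2 ∷ adversary C k) 0 ≡ false) where

  C≤arrivalCost : ∀ k → C ℕ.≤ stepCost A C (arrive 1 2) (adversary C k)
  C≤arrivalCost k rewrite present-adversary C k | kept k | dropped k = ℕP.m≤m+n C 0

  C≤departureCost : ∀ k → C ℕ.≤ stepCost A C (depart (length (adversary C k))) (arrive 1 2 ∷ adversary C k)
  C≤departureCost k
    rewrite present-adversary C k | dropped k | kept (suc k) | length-adversary C k | ≡ᵇ-refl (k + k)
    with A C (arrive 1 2 ∷ adversary C k) (suc (k + k))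
  ... | true  = ℕP.m≤n⇒m≤1+n (ℕP.m≤m+n C 0)
  ... | false = ℕP.m≤m+n C 0

  k*2C≤totalCost-adversary : ∀ k → k * (C + C) ℕ.≤ totalCost A C (adversary C k)
  k*2C≤totalCost-adversary zero    = z≤n
  k*2C≤totalCost-adversary (suc k) = subst (ℕ._≤ totalCost A C (adversary C (suc k)))
    (sym (ℕP.+-assoc C C (k * (C + C))))
    (ℕP.+-mono-≤ (C≤departureCost k) (ℕP.+-mono-≤ (C≤arrivalCost k) (k*2C≤totalCost-adversary k)))

theorem19 : (α : ℚ) → ½ < α → ¬ (Σ Algorithm λ A → Σ ℚ λ B → GoodAlgorithm α B A)
theorem19 α ½<α (A , B , good) = ℕP.<⇒≱ (m*3n<n*2n m N (s≤s (ℕP.m≤m+n _ _))) (ℕP.≤-trans lower upper)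
  where
  m N : ℕ
  m = ∣ ↥ B ∣
  N = suc (m + m + m)

  kept : ∀ k → A N (adversary N k) 0 ≡ true
  kept k = large-kept (ℚP.<-trans (ℚP.positive⁻¹ ½) ½<α) A N (adversary N k) (present-adversary N k)
             (proj₁ (proj₂ (good N (adversary N k) (valid-adversary N k))))

  dropped : ∀ k → A N (arrive 1 2 ∷ adversary N k) 0 ≡ false
  dropped k = large-dropped ½<α A N (k + k) h (s≤s z≤n) (present-adversary-arrive N k)
                (proj₁ (good N h (valid-adversary N k))) (proj₁ (proj₂ (good N h (valid-adversary N k))))
    where h = arrive 1 2 ∷ adversary N k

  lower : N * (N + N) ℕ.≤ totalCost A N (adversary N N)
  lower = k*2C≤totalCost-adversary A N kept dropped N

  upper : totalCost A N (adversary N N) ℕ.≤ m * (N + (N + N))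
  upper = subst (λ P → totalCost A N (adversary N N) ℕ.≤ m * P) (totalPotential-adversary N N)
            (toℚ≤q*toℚ⇒≤∣↥q∣* B _ _ (proj₂ (proj₂ (good N (adversary N N) (valid-adversary N N)))))
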